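{- Let $L$ be a residuated lattice, let $n\geq 1$ be an integer, and let $F_1$ and $F_2$ be filters of $L$ with $F_1\subseteq F_2$. If $F_1$ is an $n$-fold implicative filter of $L$, then $F_2$ is an $n$-fold implicative filter of $L$.
   Context: A residuated lattice is an algebra $(L,\wedge,\vee,\otimes,\rightarrow,0,1)$ such that $(L,\wedge,\vee,0,1)$ is a bounded lattice, $(L,\otimes,1)$ is a commutative monoid, and $x\otimes y\leq z$ iff $x\leq y\rightarrow z$. A filter of $L$ is a nonempty subset $F$ closed under $\otimes$ and upward closed (if $x\leq y$ and $x\in F$ then $y\in F$). For $x\in L$, $x^n=x\otimes\cdots\otimes x$ ($n$ factors). A subset $F\subseteq L$ is an $n$-fold implicative filter if $1\in F$ and for all $x,y,z\in L$: if $x^n\rightarrow(y\rightarrow z)\in F$ and $x^n\rightarrow y\in F$, then $x^n\rightarrow z\in F$. -}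

module Defs where

open import Level using (Level; suc; _⊔_)
open import Data.Nat using (ℕ; zero) renaming (suc to sucℕ)
open import Data.Product using (_×_; Σ)
open import Relation.Binary.PropositionalEquality using (_≡_)
open import Relation.Unary using (Pred; _∈_; _⊆_)
open import Algebra.Structures using (IsCommutativeMonoid)
open import Algebra.Lattice.Structures using () renaming (IsLattice to IsLatticeL)

record ResiduatedLattice (c : Level) : Set (suc c) where
  infixr 7 _⊗_
  infixr 6 _∧_
  infixr 5 _∨_
  infixr 4 _⇒_
  infix 3 _≤_
  field
    Carrier : Set c
    _∧_ _∨_ _⊗_ _⇒_ : Carrier → Carrier → Carrier
    𝟘 𝟙 : Carrier
    isLattice : IsLatticeL _≡_ _∨_ _∧_
    isCommutativeMonoid : IsCommutativeMonoid _≡_ _⊗_ 𝟙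

  _≤_ : Carrier → Carrier → Set c
  x ≤ y = x ∧ y ≡ x

  field
    𝟘-least  : ∀ x → 𝟘 ≤ x
    𝟙-greatest : ∀ x → x ≤ 𝟙
    residuation₁ : ∀ x y z → x ⊗ y ≤ z → x ≤ y ⇒ z
    residuation₂ : ∀ x y z → x ≤ y ⇒ z → x ⊗ y ≤ z

  -- x ^ n = x ⊗ ⋯ ⊗ x (n factors); x ^ 0 = 1 by convention (only n ≥ 1 used)
  _^_ : Carrier → ℕ → Carrier
  x ^ zero = 𝟙
  x ^ sucℕ zero = x
  x ^ sucℕ (sucℕ n) = x ⊗ (x ^ sucℕ n)

module _ {c : Level} (L : ResiduatedLattice c) where
  open ResiduatedLattice L

  record IsFilter {ℓ : Level} (F : Pred Carrier ℓ) : Set (c ⊔ ℓ) where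
    field
      nonempty : Σ Carrier (λ x → x ∈ F)
      ⊗-closed : ∀ {x y} → F x → F y → F (x ⊗ y)
      up-closed : ∀ {x y} → x ≤ y → F x → F y

  record IsNFoldImplicativeFilter {ℓ : Level} (n : ℕ) (F : Pred Carrier ℓ) : Set (c ⊔ ℓ) where
    field
      𝟙∈F : 𝟙 ∈ F
      implicative : ∀ x y z → F ((x ^ n) ⇒ (y ⇒ z)) → F ((x ^ n) ⇒ y) → F ((x ^ n) ⇒ z)

-- Put p = xⁿ and u = p ⇒ (p ⇒ z).  The hypotheses in F₂ give u ∈ F₂, because
-- (p ⇒ (y ⇒ z)) ⊗ (p ⇒ y) ≤ u.  By exchanging premises, p ⇒ (p ⇒ (u ⇒ z)) = u ⇒ u,
-- so it lies in F₁, as does p ⇒ p; one implicative step in F₁ yields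
-- p ⇒ (u ⇒ z) = u ⇒ (p ⇒ z) ∈ F₁ ⊆ F₂, and modus ponens with u gives p ⇒ z ∈ F₂.
-- Nothing depends on n.
module Submission where

open import Defs
open import Level using (Level)
open import Data.Nat using (ℕ; _≥_)
open import Data.Product using (proj₂)
open import Relation.Unary using (Pred; _∈_; _⊆_)
open import Relation.Binary.PropositionalEquality
  using (_≡_; refl; sym; trans; cong; subst; module ≡-Reasoning)
open import Algebra.Bundles using (CommutativeSemigroup)
open import Algebra.Structures using (IsCommutativeMonoid)
import Algebra.Lattice.Structures as LatticeStructures
import Algebra.Properties.CommutativeSemigroup as CommutativeSemigroupProperties

module ResiduatedLatticeProperties {c : Level} (L : ResiduatedLattice c) where
  open ResiduatedLattice L
  open LatticeStructures.IsLattice isLattice using (∧-comm; ∧-assoc; ∧-absorbs-∨; ∨-absorbs-∧)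
  open IsCommutativeMonoid isCommutativeMonoid
    using (assoc; comm; identityˡ; isCommutativeSemigroup)

  ⊗-commutativeSemigroup : CommutativeSemigroup c c
  ⊗-commutativeSemigroup = record { isCommutativeSemigroup = isCommutativeSemigroup }

  open CommutativeSemigroupProperties ⊗-commutativeSemigroup using (interchange; xy∙z≈xz∙y)

  ≤-refl : ∀ {x} → x ≤ x
  ≤-refl {x} = trans (cong (x ∧_) (sym (∨-absorbs-∧ x x))) (∧-absorbs-∨ x (x ∧ x))

  ≤-reflexive : ∀ {x y} → x ≡ y → x ≤ y
  ≤-reflexive refl = ≤-refl

  ≤-trans : ∀ {x y z} → x ≤ y → y ≤ z → x ≤ z
  ≤-trans {x} {y} {z} x≤y y≤z = begin
      x ∧ z        ≡⟨ cong (_∧ z) (sym x≤y) ⟩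
      (x ∧ y) ∧ z  ≡⟨ ∧-assoc x y z ⟩
      x ∧ (y ∧ z)  ≡⟨ cong (x ∧_) y≤z ⟩
      x ∧ y        ≡⟨ x≤y ⟩
      x            ∎
    where open ≡-Reasoning

  ≤-antisym : ∀ {x y} → x ≤ y → y ≤ x → x ≡ y
  ≤-antisym {x} {y} x≤y y≤x = trans (sym x≤y) (trans (∧-comm x y) y≤x)

  modus-ponens : ∀ x y → (x ⇒ y) ⊗ x ≤ y
  modus-ponens x y = residuation₂ _ x y ≤-refl

  ⊗-monoˡ-≤ : ∀ z {x y} → x ≤ y → x ⊗ z ≤ y ⊗ z
  ⊗-monoˡ-≤ z {x} {y} x≤y =
    residuation₂ x z (y ⊗ z) (≤-trans x≤y (residuation₁ y z (y ⊗ z) ≤-refl))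

  ⊗-mono-≤ : ∀ {x y u v} → x ≤ y → u ≤ v → x ⊗ u ≤ y ⊗ v
  ⊗-mono-≤ {x} {y} {u} {v} x≤y u≤v =
    ≤-trans (⊗-monoˡ-≤ u x≤y)
      (≤-trans (≤-reflexive (comm y u))
        (≤-trans (⊗-monoˡ-≤ y u≤v) (≤-reflexive (comm v y))))

  𝟙≤⇒ : ∀ {x y} → x ≤ y → 𝟙 ≤ x ⇒ y
  𝟙≤⇒ {x} {y} x≤y = residuation₁ 𝟙 x y (≤-trans (≤-reflexive (identityˡ x)) x≤y)

  ⇒-exchange-≤ : ∀ x y z → x ⇒ (y ⇒ z) ≤ y ⇒ (x ⇒ z)
  ⇒-exchange-≤ x y z = residuation₁ _ y (x ⇒ z) (residuation₁ _ x z
    (≤-trans (≤-reflexive (xy∙z≈xz∙y (x ⇒ (y ⇒ z)) y x))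
      (≤-trans (⊗-monoˡ-≤ y (modus-ponens x (y ⇒ z))) (modus-ponens y z))))

  ⇒-exchange : ∀ x y z → (x ⇒ (y ⇒ z)) ≡ (y ⇒ (x ⇒ z))
  ⇒-exchange x y z = ≤-antisym (⇒-exchange-≤ x y z) (⇒-exchange-≤ y x z)

  ⇒-ap-≤ : ∀ p y z → (p ⇒ (y ⇒ z)) ⊗ (p ⇒ y) ≤ p ⇒ (p ⇒ z)
  ⇒-ap-≤ p y z = residuation₁ _ p (p ⇒ z) (residuation₁ _ p z
    (≤-trans (≤-reflexive regroup)
      (≤-trans (⊗-mono-≤ (modus-ponens p (y ⇒ z)) (modus-ponens p y))
        (modus-ponens y z))))
    where
    regroup : (((p ⇒ (y ⇒ z)) ⊗ (p ⇒ y)) ⊗ p) ⊗ p ≡ ((p ⇒ (y ⇒ z)) ⊗ p) ⊗ ((p ⇒ y) ⊗ p)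
    regroup = trans (assoc _ p p) (interchange _ _ p p)

module FilterProperties {c ℓ : Level} (L : ResiduatedLattice c)
                        {F : Pred (ResiduatedLattice.Carrier L) ℓ} (isFilter : IsFilter L F) where
  open ResiduatedLattice L
  open ResiduatedLatticeProperties L
  open IsFilter isFilter

  𝟙∈F : 𝟙 ∈ F
  𝟙∈F = up-closed (𝟙-greatest _) (proj₂ nonempty)

  ≤⇒⇒∈F : ∀ {x y} → x ≤ y → (x ⇒ y) ∈ F
  ≤⇒⇒∈F x≤y = up-closed (𝟙≤⇒ x≤y) 𝟙∈F

  ⊗-up-closed : ∀ {x y z} → x ∈ F → y ∈ F → x ⊗ y ≤ z → z ∈ F
  ⊗-up-closed x∈F y∈F x⊗y≤z = up-closed x⊗y≤z (⊗-closed x∈F y∈F)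

  modus-ponens-closed : ∀ {x y} → x ∈ F → (x ⇒ y) ∈ F → y ∈ F
  modus-ponens-closed {x} {y} x∈F x⇒y∈F = ⊗-up-closed x⇒y∈F x∈F (modus-ponens x y)

theorem4p13 : ∀ {c ℓ₁ ℓ₂ : Level} (L : ResiduatedLattice c) (n : ℕ) → n ≥ 1 → (F₁ : Pred (ResiduatedLattice.Carrier L) ℓ₁) → (F₂ : Pred (ResiduatedLattice.Carrier L) ℓ₂) → IsFilter L F₁ → IsFilter L F₂ → F₁ ⊆ F₂ → IsNFoldImplicativeFilter L n F₁ → IsNFoldImplicativeFilter L n F₂
theorem4p13 L n _ F₁ F₂ isFilter₁ isFilter₂ F₁⊆F₂ implicative₁ = record
  { 𝟙∈F = F₂.𝟙∈F
  ; implicative = implicative₂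
  }
  where
  open ResiduatedLattice L
  open ResiduatedLatticeProperties L
  open IsNFoldImplicativeFilter implicative₁ using (implicative)
  module F₁ = FilterProperties L isFilter₁
  module F₂ = FilterProperties L isFilter₂

  implicative₂ : ∀ x y z → ((x ^ n) ⇒ (y ⇒ z)) ∈ F₂ → ((x ^ n) ⇒ y) ∈ F₂ → ((x ^ n) ⇒ z) ∈ F₂
  implicative₂ x y z hyp₁ hyp₂ =
    F₂.modus-ponens-closed u∈F₂ (subst F₂ (⇒-exchange p u z) (F₁⊆F₂ p⇒u⇒z∈F₁))
    where
    p = x ^ n
    u = p ⇒ (p ⇒ z)
    u∈F₂ : u ∈ F₂
    u∈F₂ = F₂.⊗-up-closed hyp₁ hyp₂ (⇒-ap-≤ p y z)
    u⇒u≡p⇒p⇒u⇒z : (u ⇒ u) ≡ (p ⇒ (p ⇒ (u ⇒ z)))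
    u⇒u≡p⇒p⇒u⇒z = trans (⇒-exchange u p (p ⇒ z)) (cong (p ⇒_) (⇒-exchange u p z))
    p⇒u⇒z∈F₁ : (p ⇒ (u ⇒ z)) ∈ F₁
    p⇒u⇒z∈F₁ = implicative x p (u ⇒ z)
      (subst F₁ u⇒u≡p⇒p⇒u⇒z (F₁.≤⇒⇒∈F ≤-refl)) (F₁.≤⇒⇒∈F ≤-refl)
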